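{- Let $n\ge 4$ be even and let $\tilde d=(n^2,(n/2)^{n-2})$. Then $\mathrm{TotMult}^{bi}(\tilde d)=n/2$, and every bipartite multigraph $H$ realizing $\tilde d$ with $\mathrm{TotMult}(H)=\mathrm{TotMult}^{bi}(\tilde d)$ satisfies $\mathrm{MaxMult}(H)\ge n/2+1$.
   Context: Multigraphs are loopless (parallel edges allowed); a multigraph is bipartite if its underlying simple graph is bipartite. $H$ realizes $d$ if its degree sequence equals $d$. For a multigraph $H=(V,E)$, $\mathrm{TotMult}(H)=|E|-|E'|$ with $E'$ the edge set of the underlying simple graph, and $\mathrm{MaxMult}(H)$ is the maximum number of parallel copies of an edge. $\mathrm{TotMult}^{bi}(d)$ is the minimum of $\mathrm{TotMult}(H)$ over all bipartite multigraphs $H$ realizing $d$. The notation $x^k$ in a sequence means $k$ entries equal to $x$. -}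

module Defs where

open import Data.Nat using (ℕ; zero; suc; _+_; _*_; _∸_; _≤_; _<_; _⊔_)
open import Data.Fin using (Fin; toℕ) renaming (zero to fzero; suc to fsuc)
open import Data.Nat.Properties using (_<?_)
open import Data.Bool using (Bool)
open import Data.Product using (Σ; _×_; ∃)
open import Relation.Nullary using (¬_; yes; no)
open import Relation.Binary.PropositionalEquality using (_≡_; _≢_)

∑ : ∀ {m} → (Fin m → ℕ) → ℕ
∑ {zero}  f = 0
∑ {suc m} f = f fzero + ∑ (λ i → f (fsuc i))

maxF : ∀ {m} → (Fin m → ℕ) → ℕ
maxF {zero}  f = 0
maxF {suc m} f = f fzero ⊔ maxF (λ i → f (fsuc i))

record Multigraph (m : ℕ) : Set where
  field
    mult     : Fin m → Fin m → ℕ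
    symm     : ∀ i j → mult i j ≡ mult j i
    loopless : ∀ i → mult i i ≡ 0
open Multigraph public

deg : ∀ {m} → Multigraph m → Fin m → ℕ
deg H v = ∑ (λ u → mult H v u)

Realizes : ∀ {m} → Multigraph m → (Fin m → ℕ) → Set
Realizes H d = ∀ i → deg H i ≡ d i

Bipartite : ∀ {m} → Multigraph m → Set
Bipartite {m} H = Σ (Fin m → Bool) λ c → ∀ i j → 0 < mult H i j → c i ≢ c j

-- summand over an unordered pair {i,j}, counted once (i < j)
pairTerm : ∀ {m} → (Fin m → Fin m → ℕ) → Fin m → Fin m → ℕ
pairTerm f i j with toℕ i <? toℕ j
... | yes _ = f i j
... | no  _ = 0

-- TotMult H = |E| - |E'| = Σ over unordered pairs of (mult - 1) for present edges
TotMult : ∀ {m} → Multigraph m → ℕ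
TotMult H = ∑ λ i → ∑ λ j → pairTerm (λ a b → mult H a b ∸ 1) i j

MaxMult : ∀ {m} → Multigraph m → ℕ
MaxMult H = maxF λ i → maxF λ j → mult H i j

IsTotMultBi : ∀ {m} → (Fin m → ℕ) → ℕ → Set
IsTotMultBi {m} d t =
  (Σ (Multigraph m) λ H → Bipartite H × Realizes H d × TotMult H ≡ t)
  × (∀ (H : Multigraph m) → Bipartite H → Realizes H d → t ≤ TotMult H)

-- the sequence (n^2, (n/2)^(n-2)) for n = 2k, i.e. two entries n and n-2 entries k
dTilde : (k : ℕ) → Fin (2 * k) → ℕ
dTilde k i with toℕ i <? 2
... | yes _ = 2 * k
... | no  _ = k

-- Fix a proper 2-colouring of H with colour classes of sizes a and b, so a + b = 2k.  Every pair
-- of vertices carries at most one edge that is not a surplus parallel copy, and only pairs from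
-- different classes carry edges at all, so by AM-GM
--   2k² + 2k = ∑ deg ≤ 2 TotMult(H) + 2ab ≤ 2 TotMult(H) + 2k²,
-- i.e. TotMult(H) ≥ k, attained by K_{k,k} plus k extra copies of the edge v₀v₁.
-- If TotMult(H) = k, all these inequalities are tight: a = b = k and H contains K_{k,k}.  A vertex
-- v ∉ {v₀, v₁} has degree k, so its edges are exactly those of K_{k,k}.  Hence v₀ has k − ε edges
-- to such vertices, where ε = 1 iff v₀ and v₁ lie in different classes, and mult(v₀v₁) = k + ε > 0;
-- so v₀v₁ is an edge, ε = 1, and MaxMult(H) ≥ k + 1.

{-# OPTIONS --safe #-}
module Submission where

open import Defs
open import Algebra.Properties.CommutativeSemigroup as CommSemigroup using ()
open import Data.Bool.Base using (Bool; true; false; not; _xor_)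
open import Data.Bool.Properties using (_≟_; xor-comm; xor-same)
open import Data.Fin.Base using (Fin; toℕ) renaming (zero to fzero; suc to fsuc)
open import Data.Fin.Properties using (toℕ-injective)
open import Data.Nat.Base
  using (ℕ; zero; suc; _+_; _*_; _∸_; _≤_; _<_; _<ᵇ_; ∣_-_∣; z≤n; s≤s)
open import Data.Nat.Properties
  using ( _<?_; ≤-reflexive; ≤-trans; ≤-antisym; ≤-total; n≤1+n; <-cmp; m≤n⇒∃[o]m+o≡n
        ; m≤m+n; m≤n+m; m≤m⊔n; m≤n⊔m; n≤0⇒n≡0
        ; +-comm; +-assoc; +-identityʳ; *-comm; *-identityʳ; *-zeroʳ; *-distribˡ-+
        ; +-mono-≤; +-monoʳ-≤; *-monoʳ-≤; +-monoˡ-≤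
        ; +-cancelˡ-≤; +-cancelʳ-≤; +-cancelˡ-≡; +-cancelʳ-≡; *-cancelˡ-≤; *-cancelˡ-≡
        ; m+n∸n≡m; ∣m-m+n∣≡n; ∣-∣-comm; ∣m-n∣≡0⇒m≡n; m*n≡0⇒m≡0∨n≡0
        ; +-commutativeSemigroup; module ≤-Reasoning )
open import Data.Nat.Tactic.RingSolver using (solve-∀)
open import Data.Product.Base using (_×_; _,_; proj₁; proj₂)
open import Data.Sum.Base using ([_,_]′; reduce)
open import Function.Base using (_∘_)
open import Relation.Binary.Definitions using (tri<; tri≈; tri>)
open import Relation.Binary.PropositionalEquality
  using (_≡_; _≢_; refl; sym; trans; cong; cong₂; subst; module ≡-Reasoning)
open import Relation.Nullary.Decidable.Core using (does; yes; no)
open import Relation.Nullary.Negation.Core using (¬_; contradiction)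

open CommSemigroup +-commutativeSemigroup using (interchange; x∙yz≈y∙xz)

∑-cong : ∀ {m} {f g : Fin m → ℕ} → (∀ i → f i ≡ g i) → ∑ f ≡ ∑ g
∑-cong {zero}  f≗g = refl
∑-cong {suc m} f≗g = cong₂ _+_ (f≗g fzero) (∑-cong (f≗g ∘ fsuc))

∑-mono-≤ : ∀ {m} {f g : Fin m → ℕ} → (∀ i → f i ≤ g i) → ∑ f ≤ ∑ g
∑-mono-≤ {zero}  f≤g = z≤n
∑-mono-≤ {suc m} f≤g = +-mono-≤ (f≤g fzero) (∑-mono-≤ (f≤g ∘ fsuc))

∑-const : ∀ m a → ∑ {m} (λ _ → a) ≡ m * a
∑-const zero    a = refl
∑-const (suc m) a = cong (a +_) (∑-const m a)

∑-0 : ∀ {m} → ∑ {m} (λ _ → 0) ≡ 0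
∑-0 {m} = trans (∑-const m 0) (*-zeroʳ m)

∑-distrib-+ : ∀ {m} (f g : Fin m → ℕ) → ∑ (λ i → f i + g i) ≡ ∑ f + ∑ g
∑-distrib-+ {zero}  f g = refl
∑-distrib-+ {suc m} f g =
  trans (cong (f fzero + g fzero +_) (∑-distrib-+ (f ∘ fsuc) (g ∘ fsuc)))
        (interchange (f fzero) (g fzero) (∑ (f ∘ fsuc)) (∑ (g ∘ fsuc)))

∑-comm : ∀ {m n} (f : Fin m → Fin n → ℕ) →
         ∑ (λ i → ∑ (f i)) ≡ ∑ (λ j → ∑ (λ i → f i j))
∑-comm {zero} {n} f = sym (∑-0 {n})
∑-comm {suc m} f =
  trans (cong (∑ (f fzero) +_) (∑-comm (f ∘ fsuc)))
        (sym (∑-distrib-+ (f fzero) (λ j → ∑ (λ i → f (fsuc i) j))))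

+-tight : ∀ {a b c d} → a ≤ b → c ≤ d → b + d ≤ a + c → a ≡ b × c ≡ d
+-tight {a} {b} {c} {d} a≤b c≤d b+d≤a+c =
    ≤-antisym a≤b (+-cancelʳ-≤ d b a (≤-trans b+d≤a+c (+-monoʳ-≤ a c≤d)))
  , ≤-antisym c≤d (+-cancelˡ-≤ b d c (≤-trans b+d≤a+c (+-monoˡ-≤ c a≤b)))

∑-tight : ∀ {m} {f g : Fin m → ℕ} → (∀ i → f i ≤ g i) → ∑ g ≤ ∑ f → ∀ i → f i ≡ g i
∑-tight {suc m} f≤g ∑g≤∑f fzero    = proj₁ (+-tight (f≤g fzero) (∑-mono-≤ (f≤g ∘ fsuc)) ∑g≤∑f)
∑-tight {suc m} f≤g ∑g≤∑f (fsuc i) =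
  ∑-tight (f≤g ∘ fsuc)
          (≤-reflexive (sym (proj₂ (+-tight (f≤g fzero) (∑-mono-≤ (f≤g ∘ fsuc)) ∑g≤∑f)))) i

∑∑ : ∀ {m n} → (Fin m → Fin n → ℕ) → ℕ
∑∑ f = ∑ λ i → ∑ (f i)

∑∑-cong : ∀ {m n} {f g : Fin m → Fin n → ℕ} → (∀ i j → f i j ≡ g i j) → ∑∑ f ≡ ∑∑ g
∑∑-cong f≗g = ∑-cong (∑-cong ∘ f≗g)

∑∑-mono-≤ : ∀ {m n} {f g : Fin m → Fin n → ℕ} → (∀ i j → f i j ≤ g i j) → ∑∑ f ≤ ∑∑ g
∑∑-mono-≤ f≤g = ∑-mono-≤ (∑-mono-≤ ∘ f≤g)

∑∑-distrib-+ : ∀ {m n} (f g : Fin m → Fin n → ℕ) →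
               ∑∑ (λ i j → f i j + g i j) ≡ ∑∑ f + ∑∑ g
∑∑-distrib-+ f g =
  trans (∑-cong (λ i → ∑-distrib-+ (f i) (g i))) (∑-distrib-+ (∑ ∘ f) (∑ ∘ g))

∑∑-tight : ∀ {m n} {f g : Fin m → Fin n → ℕ} → (∀ i j → f i j ≤ g i j) →
           ∑∑ g ≤ ∑∑ f → ∀ i j → f i j ≡ g i j
∑∑-tight f≤g ∑∑g≤∑∑f i =
  ∑-tight (f≤g i) (≤-reflexive (sym (∑-tight (∑-mono-≤ ∘ f≤g) ∑∑g≤∑∑f i)))

≤-maxF : ∀ {m} (f : Fin m → ℕ) i → f i ≤ maxF f
≤-maxF f fzero    = m≤m⊔n _ _
≤-maxF f (fsuc i) = ≤-trans (≤-maxF (f ∘ fsuc) i) (m≤n⊔m _ _)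

pairTerm-< : ∀ {m} (g : Fin m → Fin m → ℕ) {i j} → toℕ i < toℕ j → pairTerm g i j ≡ g i j
pairTerm-< g {i} {j} i<j with toℕ i <? toℕ j
... | yes _   = refl
... | no  i≮j = contradiction i<j i≮j

pairTerm-≮ : ∀ {m} (g : Fin m → Fin m → ℕ) {i j} → ¬ toℕ i < toℕ j → pairTerm g i j ≡ 0
pairTerm-≮ g {i} {j} i≮j with toℕ i <? toℕ j
... | yes i<j = contradiction i<j i≮j
... | no  _   = refl

pairTerm-+-flip : ∀ {m} (g : Fin m → Fin m → ℕ) → (∀ i j → g i j ≡ g j i) → (∀ i → g i i ≡ 0) →
                  ∀ i j → pairTerm g i j + pairTerm g j i ≡ g i j
pairTerm-+-flip g symmetric loopless i j with <-cmp (toℕ i) (toℕ j)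
... | tri< i<j _ j≮i =
  trans (cong₂ _+_ (pairTerm-< g i<j) (pairTerm-≮ g j≮i)) (+-identityʳ (g i j))
... | tri> i≮j _ j<i =
  trans (cong₂ _+_ (pairTerm-≮ g i≮j) (pairTerm-< g j<i)) (symmetric j i)
... | tri≈ i≮j i≡j _ with toℕ-injective i≡j
... | refl = trans (cong₂ _+_ (pairTerm-≮ g i≮j) (pairTerm-≮ g i≮j)) (sym (loopless i))

∑∑≡2*∑∑-pairTerm : ∀ {m} (g : Fin m → Fin m → ℕ) → (∀ i j → g i j ≡ g j i) → (∀ i → g i i ≡ 0) →
                   ∑∑ g ≡ 2 * ∑∑ (pairTerm g)
∑∑≡2*∑∑-pairTerm g symmetric loopless = begin
  ∑∑ g                                  ≡⟨ ∑∑-cong (pairTerm-+-flip g symmetric loopless) ⟨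
  ∑∑ (λ i j → P i j + P j i)            ≡⟨ ∑∑-distrib-+ P (λ i j → P j i) ⟩
  ∑∑ P + ∑∑ (λ i j → P j i)             ≡⟨ cong (∑∑ P +_) (∑-comm P) ⟨
  ∑∑ P + ∑∑ P                           ≡⟨ cong (∑∑ P +_) (+-identityʳ (∑∑ P)) ⟨
  2 * ∑∑ P                              ∎
  where
  open ≡-Reasoning
  P : Fin _ → Fin _ → ℕ
  P = pairTerm g

excess : ∀ {m} → Multigraph m → Fin m → Fin m → ℕ
excess H i j = mult H i j ∸ 1

∑∑-excess : ∀ {m} (H : Multigraph m) → ∑∑ (excess H) ≡ 2 * TotMult H
∑∑-excess H =
  ∑∑≡2*∑∑-pairTerm (excess H) (λ i j → cong (_∸ 1) (symm H i j)) (cong (_∸ 1) ∘ loopless H)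

mult≤MaxMult : ∀ {m} (H : Multigraph m) i j → mult H i j ≤ MaxMult H
mult≤MaxMult H i j = ≤-trans (≤-maxF (mult H i) j) (≤-maxF (maxF ∘ mult H) i)

⟦_⟧ : Bool → ℕ
⟦ true  ⟧ = 1
⟦ false ⟧ = 0

⟦_⟧∸1 : ∀ b → ⟦ b ⟧ ∸ 1 ≡ 0
⟦ true  ⟧∸1 = refl
⟦ false ⟧∸1 = refl

≢⇒⟦xor⟧≡1 : ∀ {a b} → a ≢ b → ⟦ a xor b ⟧ ≡ 1
≢⇒⟦xor⟧≡1 {true}  {true}  a≢b = contradiction refl a≢b
≢⇒⟦xor⟧≡1 {true}  {false} _   = refl
≢⇒⟦xor⟧≡1 {false} {true}  _   = refl
≢⇒⟦xor⟧≡1 {false} {false} a≢b = contradiction refl a≢b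

0<⟦xor⟧⇒≢ : ∀ {a b} → 0 < ⟦ a xor b ⟧ → a ≢ b
0<⟦xor⟧⇒≢ {true}  {true}  ()
0<⟦xor⟧⇒≢ {false} {false} ()
0<⟦xor⟧⇒≢ {true}  {false} _ ()
0<⟦xor⟧⇒≢ {false} {true}  _ ()

Proper : ∀ {m} → Multigraph m → (Fin m → Bool) → Set
Proper H c = ∀ i j → 0 < mult H i j → c i ≢ c j

classSize : ∀ {m} → (Fin m → Bool) → Bool → ℕ
classSize c b = ∑ λ i → ⟦ does (c i ≟ b) ⟧

completeBipartite : ∀ {m} → (Fin m → Bool) → Fin m → Fin m → ℕ
completeBipartite c i j = ⟦ c i xor c j ⟧

classSize-true+false : ∀ {m} (c : Fin m → Bool) → classSize c true + classSize c false ≡ m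
classSize-true+false {m} c = begin
  classSize c true + classSize c false
    ≡⟨ ∑-distrib-+ (λ i → ⟦ does (c i ≟ true) ⟧) _ ⟨
  ∑ (λ i → ⟦ does (c i ≟ true) ⟧ + ⟦ does (c i ≟ false) ⟧)
    ≡⟨ ∑-cong (one-class ∘ c) ⟩
  ∑ {m} (λ _ → 1)
    ≡⟨ ∑-const m 1 ⟩
  m * 1
    ≡⟨ *-identityʳ m ⟩
  m ∎
  where
  open ≡-Reasoning
  one-class : ∀ b → ⟦ does (b ≟ true) ⟧ + ⟦ does (b ≟ false) ⟧ ≡ 1
  one-class true  = refl
  one-class false = refl

∑-completeBipartite : ∀ {m} (c : Fin m → Bool) v →
                      ∑ (completeBipartite c v) ≡ classSize c (not (c v))
∑-completeBipartite c v = ∑-cong (λ j → ⟦xor⟧≡⟦≟not⟧ (c v) (c j))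
  where
  ⟦xor⟧≡⟦≟not⟧ : ∀ a b → ⟦ a xor b ⟧ ≡ ⟦ does (b ≟ not a) ⟧
  ⟦xor⟧≡⟦≟not⟧ true  true  = refl
  ⟦xor⟧≡⟦≟not⟧ true  false = refl
  ⟦xor⟧≡⟦≟not⟧ false true  = refl
  ⟦xor⟧≡⟦≟not⟧ false false = refl

∑-∘-colouring : ∀ {m} (c : Fin m → Bool) (f : Bool → ℕ) →
                ∑ (f ∘ c) ≡ classSize c true * f true + classSize c false * f false
∑-∘-colouring {zero}  c f = refl
∑-∘-colouring {suc m} c f with c fzero | ∑-∘-colouring (c ∘ fsuc) f
... | true  | ih = trans (cong (f true +_) ih) (sym (+-assoc (f true) _ _))
... | false | ih = trans (cong (f false +_) ih)
                         (x∙yz≈y∙xz (f false) (classSize (c ∘ fsuc) true * f true) _)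

∑-completeBipartite≡ : ∀ {m k} (c : Fin m → Bool) → (∀ b → classSize c b ≡ k) →
                       ∀ v → ∑ (completeBipartite c v) ≡ k
∑-completeBipartite≡ c balanced v = trans (∑-completeBipartite c v) (balanced (not (c v)))

∑∑-completeBipartite : ∀ {m} (c : Fin m → Bool) →
                       ∑∑ (completeBipartite c) ≡ 2 * (classSize c true * classSize c false)
∑∑-completeBipartite c = begin
  ∑∑ (completeBipartite c)           ≡⟨ ∑-cong (∑-completeBipartite c) ⟩
  ∑ (classSize c ∘ not ∘ c)          ≡⟨ ∑-∘-colouring c (classSize c ∘ not) ⟩
  T * F + F * T                      ≡⟨ cong (T * F +_) (trans (*-comm F T) (sym (+-identityʳ _))) ⟩
  2 * (T * F)                        ∎
  where
  open ≡-Reasoning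
  T F : ℕ
  T = classSize c true
  F = classSize c false

module _ {m} (H : Multigraph m) (c : Fin m → Bool) (proper : Proper H c) where

  mult≤excess+completeBipartite : ∀ i j → mult H i j ≤ excess H i j + completeBipartite c i j
  mult≤excess+completeBipartite i j with mult H i j in eq
  ... | zero  = z≤n
  ... | suc μ = ≤-reflexive (trans (+-comm 1 μ) (cong (μ +_) (sym (≢⇒⟦xor⟧≡1 c-differ))))
    where
    c-differ : c i ≢ c j
    c-differ = proper i j (subst (0 <_) (sym eq) (s≤s z≤n))

  ∑∑-excess+completeBipartite :
    ∑∑ (λ i j → excess H i j + completeBipartite c i j)
      ≡ 2 * (TotMult H + classSize c true * classSize c false)
  ∑∑-excess+completeBipartite = begin
    ∑∑ (λ i j → excess H i j + completeBipartite c i j)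
      ≡⟨ ∑∑-distrib-+ (excess H) (completeBipartite c) ⟩
    ∑∑ (excess H) + ∑∑ (completeBipartite c)
      ≡⟨ cong₂ _+_ (∑∑-excess H) (∑∑-completeBipartite c) ⟩
    2 * TotMult H + 2 * (classSize c true * classSize c false)
      ≡⟨ *-distribˡ-+ 2 (TotMult H) _ ⟨
    2 * (TotMult H + classSize c true * classSize c false)
      ∎
    where open ≡-Reasoning

  ∑deg≤ : ∑ (deg H) ≤ 2 * (TotMult H + classSize c true * classSize c false)
  ∑deg≤ = ≤-trans (∑∑-mono-≤ mult≤excess+completeBipartite)
                  (≤-reflexive ∑∑-excess+completeBipartite)

  ∑deg-tight⇒completeBipartite≤mult :
    2 * (TotMult H + classSize c true * classSize c false) ≤ ∑ (deg H) →
    ∀ i j → completeBipartite c i j ≤ mult H i j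
  ∑deg-tight⇒completeBipartite≤mult tight i j =
    ≤-trans (m≤n+m _ (excess H i j)) (≤-reflexive (sym (mult≡ i j)))
    where
    mult≡ : ∀ i j → mult H i j ≡ excess H i j + completeBipartite c i j
    mult≡ = ∑∑-tight mult≤excess+completeBipartite
                     (≤-trans (≤-reflexive ∑∑-excess+completeBipartite) tight)

[m+n]²≡4mn+∣m-n∣² : ∀ m n → (m + n) * (m + n) ≡ 4 * (m * n) + ∣ m - n ∣ * ∣ m - n ∣
[m+n]²≡4mn+∣m-n∣² m n = [ ordered , flipped ]′ (≤-total m n)
  where
  ordered : ∀ {a b} → a ≤ b → (a + b) * (a + b) ≡ 4 * (a * b) + ∣ a - b ∣ * ∣ a - b ∣
  ordered {a} a≤b with m≤n⇒∃[o]m+o≡n a≤b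
  ... | d , refl =
    trans (identity a d) (cong (λ x → 4 * (a * (a + d)) + x * x) (sym (∣m-m+n∣≡n a d)))
    where
    identity : ∀ a d → (a + (a + d)) * (a + (a + d)) ≡ 4 * (a * (a + d)) + d * d
    identity = solve-∀
  flipped : n ≤ m → (m + n) * (m + n) ≡ 4 * (m * n) + ∣ m - n ∣ * ∣ m - n ∣
  flipped n≤m = begin
    (m + n) * (m + n)
      ≡⟨ cong (λ x → x * x) (+-comm m n) ⟩
    (n + m) * (n + m)
      ≡⟨ ordered n≤m ⟩
    4 * (n * m) + ∣ n - m ∣ * ∣ n - m ∣
      ≡⟨ cong₂ (λ x y → 4 * x + y * y) (*-comm n m) (∣-∣-comm n m) ⟩
    4 * (m * n) + ∣ m - n ∣ * ∣ m - n ∣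
      ∎
    where open ≡-Reasoning

module _ {m n k : ℕ} (m+n≡2k : m + n ≡ 2 * k) where

  private
    4kk≡4mn+δ² : 4 * (k * k) ≡ 4 * (m * n) + ∣ m - n ∣ * ∣ m - n ∣
    4kk≡4mn+δ² = begin
      4 * (k * k)        ≡⟨ square-double k ⟩
      2 * k * (2 * k)    ≡⟨ cong (λ x → x * x) m+n≡2k ⟨
      (m + n) * (m + n)  ≡⟨ [m+n]²≡4mn+∣m-n∣² m n ⟩
      4 * (m * n) + ∣ m - n ∣ * ∣ m - n ∣ ∎
      where
      open ≡-Reasoning
      square-double : ∀ k → 4 * (k * k) ≡ 2 * k * (2 * k)
      square-double = solve-∀

  m+n≡2k⇒m*n≤k*k : m * n ≤ k * k
  m+n≡2k⇒m*n≤k*k = *-cancelˡ-≤ 4 (≤-trans (m≤m+n _ _) (≤-reflexive (sym 4kk≡4mn+δ²)))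

  m+n≡2k⇒k*k≤m*n⇒m≡k : k * k ≤ m * n → m ≡ k
  m+n≡2k⇒k*k≤m*n⇒m≡k k*k≤m*n =
    *-cancelˡ-≡ m k 2 (trans (cong (m +_) (trans (+-identityʳ m) m≡n)) m+n≡2k)
    where
    δ²≡0 : ∣ m - n ∣ * ∣ m - n ∣ ≡ 0
    δ²≡0 = n≤0⇒n≡0 (+-cancelˡ-≤ (4 * (m * n)) _ 0 (begin
      4 * (m * n) + ∣ m - n ∣ * ∣ m - n ∣  ≡⟨ 4kk≡4mn+δ² ⟨
      4 * (k * k)                          ≤⟨ *-monoʳ-≤ 4 k*k≤m*n ⟩
      4 * (m * n)                          ≡⟨ +-identityʳ _ ⟨
      4 * (m * n) + 0                      ∎))
      where open ≤-Reasoning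
    m≡n : m ≡ n
    m≡n = ∣m-n∣≡0⇒m≡n (reduce (m*n≡0⇒m≡0∨n≡0 _ δ²≡0))

classSize-balanced : ∀ {k} (c : Fin (2 * k) → Bool) → classSize c true ≡ k →
                     ∀ b → classSize c b ≡ k
classSize-balanced     c T≡k true  = T≡k
classSize-balanced {k} c T≡k false = +-cancelˡ-≡ k (classSize c false) k (begin
  k + classSize c false                 ≡⟨ cong (_+ classSize c false) T≡k ⟨
  classSize c true + classSize c false  ≡⟨ classSize-true+false c ⟩
  k + (k + 0)                           ≡⟨ cong (k +_) (+-identityʳ k) ⟩
  k + k                                 ∎)
  where open ≡-Reasoning

count-<ᵇ : ∀ {r} s → s ≤ r → ∑ {r} (λ w → ⟦ toℕ w <ᵇ s ⟧) ≡ s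
count-<ᵇ {r} zero    _         = ∑-0 {r}
count-<ᵇ     (suc s) (s≤s s≤r) = cong suc (count-<ᵇ s s≤r)

module DTilde (t : ℕ) where

  k : ℕ
  k = 2 + t

  -- ∑ (dTilde k) unfolds to 2k + (2k + ∑ of the constant k over the remaining 2k − 2 vertices).
  ∑-dTilde : ∑ (dTilde k) ≡ 2 * (k * k + k)
  ∑-dTilde = trans (cong (λ s → 2 * k + (2 * k + s)) (∑-const (2 * k ∸ 2) k)) (identity t)
    where
    identity : ∀ t → 2 * (2 + t) + (2 * (2 + t) + (t + (2 + t + 0)) * (2 + t))
                     ≡ 2 * ((2 + t) * (2 + t) + (2 + t))
    identity = solve-∀

  module _ (H : Multigraph (2 * k)) (bipartite : Bipartite H)
           (realizes : Realizes H (dTilde k)) where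

    private
      c : Fin (2 * k) → Bool
      c = proj₁ bipartite
      proper : Proper H c
      proper = proj₂ bipartite
      T F : ℕ
      T = classSize c true
      F = classSize c false
      T+F≡2k : T + F ≡ 2 * k
      T+F≡2k = classSize-true+false c

    ∑deg≡ : ∑ (deg H) ≡ 2 * (k * k + k)
    ∑deg≡ = trans (∑-cong realizes) ∑-dTilde

    k*k+k≤TotMult+T*F : k * k + k ≤ TotMult H + T * F
    k*k+k≤TotMult+T*F = *-cancelˡ-≤ 2 (≤-trans (≤-reflexive (sym ∑deg≡)) (∑deg≤ H c proper))

    k≤TotMult : k ≤ TotMult H
    k≤TotMult = +-cancelˡ-≤ (k * k) k (TotMult H) (begin
      k * k + k          ≤⟨ k*k+k≤TotMult+T*F ⟩
      TotMult H + T * F  ≤⟨ +-monoʳ-≤ (TotMult H) (m+n≡2k⇒m*n≤k*k {T} {F} {k} T+F≡2k) ⟩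
      TotMult H + k * k  ≡⟨ +-comm (TotMult H) (k * k) ⟩
      k * k + TotMult H  ∎)
      where open ≤-Reasoning

    module _ (optimal : TotMult H ≡ k) where

      T≡k : T ≡ k
      T≡k = m+n≡2k⇒k*k≤m*n⇒m≡k {T} {F} {k} T+F≡2k (+-cancelʳ-≤ k (k * k) (T * F) (begin
        k * k + k          ≤⟨ k*k+k≤TotMult+T*F ⟩
        TotMult H + T * F  ≡⟨ cong (_+ T * F) optimal ⟩
        k + T * F          ≡⟨ +-comm k (T * F) ⟩
        T * F + k          ∎))
        where open ≤-Reasoning

      classSize≡k : ∀ b → classSize c b ≡ k
      classSize≡k = classSize-balanced c T≡k

      completeBipartite≤mult : ∀ i j → completeBipartite c i j ≤ mult H i j
      completeBipartite≤mult = ∑deg-tight⇒completeBipartite≤mult H c proper (≤-reflexive (begin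
        2 * (TotMult H + T * F)  ≡⟨ cong (λ x → 2 * (x + T * F)) optimal ⟩
        2 * (k + T * F)          ≡⟨ cong₂ (λ x y → 2 * (k + x * y)) T≡k (classSize≡k false) ⟩
        2 * (k + k * k)          ≡⟨ cong (2 *_) (+-comm k (k * k)) ⟩
        2 * (k * k + k)          ≡⟨ ∑deg≡ ⟨
        ∑ (deg H)                ∎))
        where open ≡-Reasoning

      ∑-completeBipartite≡k : ∀ v → ∑ (completeBipartite c v) ≡ k
      ∑-completeBipartite≡k = ∑-completeBipartite≡ c classSize≡k

      mult-0-tail : ∀ w → mult H fzero (fsuc (fsuc w)) ≡ completeBipartite c fzero (fsuc (fsuc w))
      mult-0-tail w = begin
        mult H fzero v                 ≡⟨ symm H fzero v ⟩
        mult H v fzero                 ≡⟨ ∑-tight (completeBipartite≤mult v) ∑mult≤∑complete fzero ⟨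
        completeBipartite c v fzero    ≡⟨ cong ⟦_⟧ (xor-comm (c v) (c fzero)) ⟩
        completeBipartite c fzero v    ∎
        where
        open ≡-Reasoning
        v : Fin (2 * k)
        v = fsuc (fsuc w)
        ∑mult≤∑complete : deg H v ≤ ∑ (completeBipartite c v)
        ∑mult≤∑complete = ≤-reflexive (trans (realizes v) (sym (∑-completeBipartite≡k v)))

      private
        R : ℕ
        R = ∑ λ w → completeBipartite c fzero (fsuc (fsuc w))

        K01 M01 : ℕ
        K01 = completeBipartite c fzero (fsuc fzero)
        M01 = mult H fzero (fsuc fzero)

      M01+R≡k+k : M01 + R ≡ k + k
      M01+R≡k+k = begin
        M01 + R      ≡⟨ cong₂ (λ x y → x + (M01 + y)) (loopless H fzero) (∑-cong mult-0-tail) ⟨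
        deg H fzero  ≡⟨ realizes fzero ⟩
        k + (k + 0)  ≡⟨ cong (k +_) (+-identityʳ k) ⟩
        k + k        ∎
        where open ≡-Reasoning

      K01+R≡k : K01 + R ≡ k
      K01+R≡k = trans (cong (λ x → ⟦ x ⟧ + (K01 + R)) (sym (xor-same (c fzero))))
                      (∑-completeBipartite≡k fzero)

      M01≡k+K01 : M01 ≡ k + K01
      M01≡k+K01 = +-cancelʳ-≡ R M01 (k + K01)
        (trans M01+R≡k+k (trans (cong (k +_) (sym K01+R≡k)) (sym (+-assoc k K01 R))))

      k+1≤MaxMult : k + 1 ≤ MaxMult H
      k+1≤MaxMult = ≤-trans (≤-reflexive (begin
        k + 1    ≡⟨ cong (k +_) (≢⇒⟦xor⟧≡1 (proper fzero (fsuc fzero) 0<M01)) ⟨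
        k + K01  ≡⟨ M01≡k+K01 ⟨
        M01      ∎)) (mult≤MaxMult H fzero (fsuc fzero))
        where
        open ≡-Reasoning
        0<M01 : 0 < M01
        0<M01 = subst (0 <_) (sym M01≡k+K01) (s≤s z≤n)

  colouring : Fin (2 * k) → Bool
  colouring fzero            = true
  colouring (fsuc fzero)     = false
  colouring (fsuc (fsuc w))  = toℕ w <ᵇ suc t

  colouring-balanced : ∀ b → classSize colouring b ≡ k
  colouring-balanced = classSize-balanced colouring
    (cong suc (trans (∑-cong (⟦≟true⟧ ∘ side)) (count-<ᵇ (suc t) suc-t≤2k-2)))
    where
    suc-t≤2k-2 : suc t ≤ 2 * k ∸ 2
    suc-t≤2k-2 =
      ≤-trans (n≤1+n (suc t)) (≤-trans (≤-reflexive (sym (+-identityʳ k))) (m≤n+m (k + 0) t))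
    side : Fin (2 * k ∸ 2) → Bool
    side w = toℕ w <ᵇ suc t
    ⟦≟true⟧ : ∀ b → ⟦ does (b ≟ true) ⟧ ≡ ⟦ b ⟧
    ⟦≟true⟧ true  = refl
    ⟦≟true⟧ false = refl

  extra : Fin (2 * k) → Fin (2 * k) → ℕ
  extra fzero        (fsuc fzero) = k
  extra (fsuc fzero) fzero        = k
  extra _            _            = 0

  extra-symm : ∀ i j → extra i j ≡ extra j i
  extra-symm fzero               fzero               = refl
  extra-symm fzero               (fsuc fzero)        = refl
  extra-symm fzero               (fsuc (fsuc _))     = refl
  extra-symm (fsuc fzero)        fzero               = refl
  extra-symm (fsuc fzero)        (fsuc fzero)        = refl
  extra-symm (fsuc fzero)        (fsuc (fsuc _))     = refl
  extra-symm (fsuc (fsuc _))     fzero               = refl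
  extra-symm (fsuc (fsuc _))     (fsuc fzero)        = refl
  extra-symm (fsuc (fsuc _))     (fsuc (fsuc _))     = refl

  extra-loopless : ∀ i → extra i i ≡ 0
  extra-loopless fzero           = refl
  extra-loopless (fsuc fzero)    = refl
  extra-loopless (fsuc (fsuc _)) = refl

  extremal : Multigraph (2 * k)
  extremal = record
    { mult     = λ i j → extra i j + completeBipartite colouring i j
    ; symm     = λ i j → cong₂ _+_ (extra-symm i j)
                                   (cong ⟦_⟧ (xor-comm (colouring i) (colouring j)))
    ; loopless = λ i → cong₂ _+_ (extra-loopless i) (cong ⟦_⟧ (xor-same (colouring i)))
    }

  extremal-proper : Proper extremal colouring
  extremal-proper fzero           (fsuc fzero)    _ ()
  extremal-proper (fsuc fzero)    fzero           _ ()
  extremal-proper fzero           fzero           = 0<⟦xor⟧⇒≢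
  extremal-proper fzero           (fsuc (fsuc _)) = 0<⟦xor⟧⇒≢
  extremal-proper (fsuc fzero)    (fsuc _)        = 0<⟦xor⟧⇒≢
  extremal-proper (fsuc (fsuc _)) _               = 0<⟦xor⟧⇒≢

  extremal-realizes : Realizes extremal (dTilde k)
  extremal-realizes v = begin
    deg extremal v
      ≡⟨ ∑-distrib-+ (extra v) (completeBipartite colouring v) ⟩
    ∑ (extra v) + ∑ (completeBipartite colouring v)
      ≡⟨ cong (∑ (extra v) +_) (∑-completeBipartite≡ colouring colouring-balanced v) ⟩
    ∑ (extra v) + k
      ≡⟨ ∑-extra+k v ⟩
    dTilde k v
      ∎
    where
    open ≡-Reasoning
    ∑-extra+k : ∀ v → ∑ (extra v) + k ≡ dTilde k v
    ∑-extra+k fzero           = trans (cong (λ s → k + s + k) (∑-0 {2 * k ∸ 2})) (+-comm (k + 0) k)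
    ∑-extra+k (fsuc fzero)    = trans (cong (λ s → k + s + k) (∑-0 {2 * k ∸ 2})) (+-comm (k + 0) k)
    ∑-extra+k (fsuc (fsuc _)) = cong (_+ k) (∑-0 {2 * k})

  excess-extremal : ∀ i j → excess extremal i j ≡ extra i j
  excess-extremal i@fzero           j@fzero           = refl
  excess-extremal i@fzero           j@(fsuc fzero)    = m+n∸n≡m k 1
  excess-extremal i@fzero           j@(fsuc (fsuc _)) = ⟦ colouring i xor colouring j ⟧∸1
  excess-extremal i@(fsuc fzero)    j@fzero           = m+n∸n≡m k 1
  excess-extremal i@(fsuc fzero)    j@(fsuc fzero)    = refl
  excess-extremal i@(fsuc fzero)    j@(fsuc (fsuc _)) = ⟦ colouring i xor colouring j ⟧∸1
  excess-extremal i@(fsuc (fsuc _)) j                 = ⟦ colouring i xor colouring j ⟧∸1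

  ∑∑-extra : ∑∑ extra ≡ 2 * k
  ∑∑-extra = trans (cong₂ (λ s s′ → k + s + (k + s + s′)) (∑-0 {2 * k ∸ 2})
                           (trans (∑-cong {2 * k ∸ 2} (λ _ → ∑-0 {2 * k})) (∑-0 {2 * k ∸ 2})))
                   (cong₂ _+_ (+-identityʳ k) (+-identityʳ (k + 0)))

  TotMult-extremal : TotMult extremal ≡ k
  TotMult-extremal = *-cancelˡ-≡ (TotMult extremal) k 2 (begin
    2 * TotMult extremal   ≡⟨ ∑∑-excess extremal ⟨
    ∑∑ (excess extremal)   ≡⟨ ∑∑-cong excess-extremal ⟩
    ∑∑ extra               ≡⟨ ∑∑-extra ⟩
    2 * k                  ∎)
    where open ≡-Reasoning

lemma16 : ∀ (k : ℕ) → 2 ≤ k →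
    IsTotMultBi (dTilde k) k
    × (∀ (H : Multigraph (2 * k)) → Bipartite H → Realizes H (dTilde k) →
         TotMult H ≡ k → k + 1 ≤ MaxMult H)
lemma16 zero          ()
lemma16 (suc zero)    (s≤s ())
lemma16 (suc (suc t)) _ =
    ( (extremal , (colouring , extremal-proper) , extremal-realizes , TotMult-extremal)
    , k≤TotMult )
  , k+1≤MaxMult
  where open DTilde t
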